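{- Let $V$ be a vector space of dimension $2r$ ($r\geq 1$) over $\mathbb{F}_2$ with a nondegenerate quadratic form $Q$. Then $V$ has a symmetric basis if and only if either $Q$ is hyperbolic and $r\equiv 0$ or $1\pmod 4$, or $Q$ is elliptic and $r\equiv 2$ or $3\pmod 4$.
   Context: Associated bilinear form: $B(u,v)=Q(u+v)-Q(u)-Q(v)$; $Q$ nondegenerate means $B$ is. A basis $\{v_1,\ldots,v_d\}$ is symmetric if $Q(v_i)=0$ for all $i$ and $B(v_i,v_j)=1$ for all $i<j$. $Q$ is hyperbolic if $V$ has a basis $e_1,\ldots,e_r,f_1,\ldots,f_r$ with $Q(e_i)=Q(f_i)=0$, $B(e_i,f_j)=\delta_{ij}$, $B(e_i,e_j)=B(f_i,f_j)=0$; $Q$ is elliptic if $V$ has a basis $e_1,\ldots,e_{r-1},f_1,\ldots,f_{r-1},x,y$ with $Q(e_i)=Q(f_i)=0$, $B(e_i,f_j)=\delta_{ij}$, $e_i,f_i$ orthogonal to $x,y$, $Q(x)=Q(y)=1$, $B(x,y)=1$. -}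

module Defs where

open import Data.Bool using (Bool; true; false; _∧_; _xor_)
open import Data.Nat using (ℕ; _∸_; _*_)
open import Data.Fin using (Fin; _<_)
open import Data.Vec using (Vec; []; _∷_; _++_; replicate; zipWith; map; lookup)
open import Data.Product using (_×_; Σ; ∃-syntax)
open import Relation.Binary.PropositionalEquality using (_≡_)

-- The field 𝔽₂ is modelled by Bool: addition = xor, multiplication = ∧.
-- The 2r-dimensional 𝔽₂-vector space V is modelled as 𝔽₂^n = Vec Bool n.

V : ℕ → Set
V n = Vec Bool n

_⊕_ : ∀ {n} → V n → V n → V n
u ⊕ v = zipWith _xor_ u v

_•_ : ∀ {n} → Bool → V n → V n
a • v = map (a ∧_) v

𝟘 : ∀ {n} → V n
𝟘 {n} = replicate n false

Bf : ∀ {n} → (V n → Bool) → V n → V n → Bool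
Bf Q u v = (Q (u ⊕ v) xor Q u) xor Q v

IsQuadraticForm : ∀ {n} → (V n → Bool) → Set
IsQuadraticForm Q =
  (∀ a v → Q (a • v) ≡ (a ∧ a) ∧ Q v)
  × (∀ u w v → Bf Q (u ⊕ w) v ≡ Bf Q u v xor Bf Q w v)
  × (∀ a u v → Bf Q (a • u) v ≡ a ∧ Bf Q u v)
  × (∀ u v w → Bf Q u (v ⊕ w) ≡ Bf Q u v xor Bf Q u w)
  × (∀ a u v → Bf Q u (a • v) ≡ a ∧ Bf Q u v)

Nondegenerate : ∀ {n} → (V n → Bool) → Set
Nondegenerate Q = ∀ u → (∀ v → Bf Q u v ≡ false) → u ≡ 𝟘

lincomb : ∀ {n m} → Vec Bool m → Vec (V n) m → V n
lincomb [] [] = 𝟘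
lincomb (c ∷ cs) (b ∷ bs) = (c • b) ⊕ lincomb cs bs

IsBasis : ∀ {n m} → Vec (V n) m → Set
IsBasis {n} {m} bs =
  (∀ (c : Vec Bool m) → lincomb c bs ≡ 𝟘 → c ≡ replicate m false)
  × (∀ (v : V n) → ∃[ c ] lincomb c bs ≡ v)

HasSymmetricBasis : ∀ {n} → (V n → Bool) → Set
HasSymmetricBasis {n} Q =
  ∃[ bs ] (IsBasis {n} {n} bs
          × (∀ i → Q (lookup bs i) ≡ false)
          × (∀ i j → i < j → Bf Q (lookup bs i) (lookup bs j) ≡ true))

δ : ∀ {k} → Fin k → Fin k → Bool
δ Fin.zero Fin.zero = true
δ Fin.zero (Fin.suc j) = false
δ (Fin.suc i) Fin.zero = false
δ (Fin.suc i) (Fin.suc j) = δ i j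

HypPairs : ∀ {n k} → (V n → Bool) → Vec (V n) k → Vec (V n) k → Set
HypPairs Q e f =
  (∀ i → Q (lookup e i) ≡ false) × (∀ i → Q (lookup f i) ≡ false)
  × (∀ i j → Bf Q (lookup e i) (lookup f j) ≡ δ i j)
  × (∀ i j → Bf Q (lookup e i) (lookup e j) ≡ false)
  × (∀ i j → Bf Q (lookup f i) (lookup f j) ≡ false)

Hyperbolic : ∀ {n} → ℕ → (V n → Bool) → Set
Hyperbolic r Q =
  ∃[ e ] ∃[ f ] (IsBasis (e ++ f) × HypPairs {k = r} Q e f)

Elliptic : ∀ {n} → ℕ → (V n → Bool) → Set
Elliptic r Q =
  ∃[ e ] ∃[ f ] ∃[ x ] ∃[ y ]
    (IsBasis (e ++ f ++ (x ∷ y ∷ []))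
    × HypPairs {k = r ∸ 1} Q e f
    × (∀ i → Bf Q (lookup e i) x ≡ false) × (∀ i → Bf Q (lookup e i) y ≡ false)
    × (∀ i → Bf Q (lookup f i) x ≡ false) × (∀ i → Bf Q (lookup f i) y ≡ false)
    × Q x ≡ true × Q y ≡ true × Bf Q x y ≡ true)

-- Let w₁, …, w₂ᵣ be a symmetric basis. The pair w₁, w₂ spans a hyperbolic plane, and replacing
-- every other wᵢ by wᵢ + w₁ + w₂ makes it orthogonal to that plane while keeping all mutual
-- products equal to 1 and flipping the value of Q. Iterating, V becomes an orthogonal sum of
-- r planes that are alternately hyperbolic and elliptic, ⌊r/2⌋ of them elliptic. Two orthogonal
-- elliptic planes span the same space as two orthogonal hyperbolic ones, so Q is elliptic exactly
-- when ⌊r/2⌋ is odd, i.e. r ≡ 2, 3 (mod 4). Every step can be reversed, which turns a hyperbolic or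
-- elliptic basis of the right kind into a symmetric one. Linear independence of each family comes
-- from a dual family for B.
module Submission where

open import Defs
open import Data.Bool using (Bool; true; false; not; _∧_; _xor_)
open import Data.Bool.Properties
  using (xor-comm; xor-assoc; xor-identityʳ; xor-same; ∧-identityʳ; ∧-zeroʳ; ∧-distribʳ-xor; not-involutive)
open import Data.Nat using (ℕ; zero; suc; _+_; _*_; _≤_; _%_; s≤s; z≤n)
open import Data.Nat.Properties using (+-comm; *-suc)
open import Data.Nat.DivMod using ([m+n]%n≡m%n; m%n<n)
open import Data.Fin using (Fin) renaming (zero to fzero; suc to fsuc; _<_ to _<ᶠ_)
open import Data.Vec using (Vec; []; _∷_; _++_; replicate; map; lookup; splitAt)
open import Data.Vec.Properties
  using (zipWith-comm; zipWith-assoc; zipWith-identityˡ; zipWith-identityʳ; map-id; lookup-map)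
open import Data.Vec.Relation.Unary.Any using (here; there; index)
open import Data.Vec.Relation.Unary.Any.Properties using (lookup-index; ++⁻)
open import Data.Vec.Membership.Propositional using (_∈_)
open import Data.Vec.Membership.Propositional.Properties using (∈-lookup; ∈-map⁺; ∈-++⁺ˡ; ∈-++⁺ʳ)
open import Data.Product using (_×_; _,_; proj₁; proj₂; Σ; ∃-syntax)
open import Data.Sum using (_⊎_; inj₁; inj₂)
open import Data.Unit using (⊤; tt)
open import Data.Empty using (⊥-elim)
open import Function.Bundles using (_⇔_; mk⇔)
open import Relation.Binary.PropositionalEquality
open import Data.Bool.Solver using (module xor-∧-Solver)
open xor-∧-Solver using (solve; _:+_; _:=_)

xor-true : ∀ q → q xor true ≡ not q
xor-true q = xor-comm q true

⊕-comm : ∀ {n} (u v : V n) → u ⊕ v ≡ v ⊕ u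
⊕-comm = zipWith-comm xor-comm

⊕-assoc : ∀ {n} (u v w : V n) → (u ⊕ v) ⊕ w ≡ u ⊕ (v ⊕ w)
⊕-assoc = zipWith-assoc xor-assoc

⊕-identityˡ : ∀ {n} (v : V n) → 𝟘 ⊕ v ≡ v
⊕-identityˡ = zipWith-identityˡ (λ _ → refl)

⊕-identityʳ : ∀ {n} (v : V n) → v ⊕ 𝟘 ≡ v
⊕-identityʳ = zipWith-identityʳ xor-identityʳ

⊕-self : ∀ {n} (v : V n) → v ⊕ v ≡ 𝟘
⊕-self []      = refl
⊕-self (a ∷ v) = cong₂ _∷_ (xor-same a) (⊕-self v)

⊕-cancelʳ : ∀ {n} (u v : V n) → (u ⊕ v) ⊕ v ≡ u
⊕-cancelʳ u v = begin
  (u ⊕ v) ⊕ v ≡⟨ ⊕-assoc u v v ⟩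
  u ⊕ (v ⊕ v) ≡⟨ cong (u ⊕_) (⊕-self v) ⟩
  u ⊕ 𝟘       ≡⟨ ⊕-identityʳ u ⟩
  u           ∎
  where open ≡-Reasoning

⊕-interchange : ∀ {n} (u v w x : V n) → (u ⊕ v) ⊕ (w ⊕ x) ≡ (u ⊕ w) ⊕ (v ⊕ x)
⊕-interchange u v w x = begin
  (u ⊕ v) ⊕ (w ⊕ x) ≡⟨ ⊕-assoc u v (w ⊕ x) ⟩
  u ⊕ (v ⊕ (w ⊕ x)) ≡⟨ cong (u ⊕_) (sym (⊕-assoc v w x)) ⟩
  u ⊕ ((v ⊕ w) ⊕ x) ≡⟨ cong (λ z → u ⊕ (z ⊕ x)) (⊕-comm v w) ⟩
  u ⊕ ((w ⊕ v) ⊕ x) ≡⟨ cong (u ⊕_) (⊕-assoc w v x) ⟩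
  u ⊕ (w ⊕ (v ⊕ x)) ≡⟨ sym (⊕-assoc u w (v ⊕ x)) ⟩
  (u ⊕ w) ⊕ (v ⊕ x) ∎
  where open ≡-Reasoning

•-zeroˡ : ∀ {n} (v : V n) → false • v ≡ 𝟘
•-zeroˡ []      = refl
•-zeroˡ (_ ∷ v) = cong (false ∷_) (•-zeroˡ v)

•-identityˡ : ∀ {n} (v : V n) → true • v ≡ v
•-identityˡ = map-id

•-distribʳ : ∀ {n} a b (v : V n) → (a xor b) • v ≡ (a • v) ⊕ (b • v)
•-distribʳ a b []      = refl
•-distribʳ a b (x ∷ v) = cong₂ _∷_ (∧-distribʳ-xor x a b) (•-distribʳ a b v)

lincomb-zero : ∀ {n m} (X : Vec (V n) m) → lincomb (replicate m false) X ≡ 𝟘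
lincomb-zero []      = refl
lincomb-zero (x ∷ X) = trans (cong₂ _⊕_ (•-zeroˡ x) (lincomb-zero X)) (⊕-identityˡ 𝟘)

lincomb-⊕ : ∀ {n m} (c d : Vec Bool m) (X : Vec (V n) m) →
  lincomb (c ⊕ d) X ≡ lincomb c X ⊕ lincomb d X
lincomb-⊕ []      []      []      = sym (⊕-identityˡ 𝟘)
lincomb-⊕ (a ∷ c) (b ∷ d) (x ∷ X) = begin
  ((a xor b) • x) ⊕ lincomb (c ⊕ d) X
    ≡⟨ cong₂ _⊕_ (•-distribʳ a b x) (lincomb-⊕ c d X) ⟩
  ((a • x) ⊕ (b • x)) ⊕ (lincomb c X ⊕ lincomb d X)
    ≡⟨ ⊕-interchange (a • x) (b • x) (lincomb c X) (lincomb d X) ⟩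
  ((a • x) ⊕ lincomb c X) ⊕ ((b • x) ⊕ lincomb d X) ∎
  where open ≡-Reasoning

lincomb-++ : ∀ {n k l} (c : Vec Bool k) (d : Vec Bool l) (X : Vec (V n) k) (Y : Vec (V n) l) →
  lincomb (c ++ d) (X ++ Y) ≡ lincomb c X ⊕ lincomb d Y
lincomb-++ []      d []      Y = sym (⊕-identityˡ _)
lincomb-++ (a ∷ c) d (x ∷ X) Y =
  trans (cong ((a • x) ⊕_) (lincomb-++ c d X Y)) (sym (⊕-assoc _ _ _))

lookup⇒∈ : ∀ {A : Set} {P : A → Set} {m} (X : Vec A m) →
  (∀ i → P (lookup X i)) → ∀ {x} → x ∈ X → P x
lookup⇒∈ {P = P} X h x∈X = subst P (sym (lookup-index x∈X)) (h (index x∈X))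

∈-shift : ∀ {A : Set} {k l} (xs : Vec A k) {y} {ys : Vec A l} {v} →
  v ∈ xs ++ (y ∷ ys) → v ∈ y ∷ (xs ++ ys)
∈-shift xs v∈ with ++⁻ xs v∈
... | inj₁ v∈xs         = there (∈-++⁺ˡ v∈xs)
... | inj₂ (here v≡y)   = here v≡y
... | inj₂ (there v∈ys) = there (∈-++⁺ʳ xs v∈ys)

∈-unshift : ∀ {A : Set} {k l} (xs : Vec A k) {y} {ys : Vec A l} {v} →
  v ∈ y ∷ (xs ++ ys) → v ∈ xs ++ (y ∷ ys)
∈-unshift xs (here v≡y) = ∈-++⁺ʳ xs (here v≡y)
∈-unshift xs (there v∈) with ++⁻ xs v∈
... | inj₁ v∈xs = ∈-++⁺ˡ v∈xs
... | inj₂ v∈ys = ∈-++⁺ʳ xs (there v∈ys)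

∈-rotate : ∀ {A : Set} {k l m} (xs : Vec A k) (ys : Vec A l) {zs : Vec A m} {v} →
  v ∈ xs ++ (ys ++ zs) → v ∈ zs ++ (xs ++ ys)
∈-rotate xs ys {zs} v∈ with ++⁻ xs v∈
... | inj₁ v∈xs = ∈-++⁺ʳ zs (∈-++⁺ˡ v∈xs)
... | inj₂ v∈′ with ++⁻ ys v∈′
...   | inj₁ v∈ys = ∈-++⁺ʳ zs (∈-++⁺ʳ xs v∈ys)
...   | inj₂ v∈zs = ∈-++⁺ˡ v∈zs

∈-unrotate : ∀ {A : Set} {k l m} (xs : Vec A k) (ys : Vec A l) (zs : Vec A m) {v} →
  v ∈ zs ++ (xs ++ ys) → v ∈ xs ++ (ys ++ zs)
∈-unrotate xs ys zs v∈ with ++⁻ zs v∈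
... | inj₁ v∈zs = ∈-++⁺ʳ xs (∈-++⁺ʳ ys v∈zs)
... | inj₂ v∈′ with ++⁻ xs v∈′
...   | inj₁ v∈xs = ∈-++⁺ˡ v∈xs
...   | inj₂ v∈ys = ∈-++⁺ʳ xs (∈-++⁺ˡ v∈ys)

∀∈-map : ∀ {A : Set} {P : A → Set} {m} (f : A → A) (xs : Vec A m) →
  (∀ {x} → x ∈ xs → P (f x)) → ∀ {y} → y ∈ map f xs → P y
∀∈-map f (x ∷ xs) h (here refl) = h (here refl)
∀∈-map f (x ∷ xs) h (there y∈)  = ∀∈-map f xs (λ x∈ → h (there x∈)) y∈

δ-sym : ∀ {k} (i j : Fin k) → δ i j ≡ δ j i
δ-sym fzero    fzero    = refl
δ-sym fzero    (fsuc j) = refl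
δ-sym (fsuc i) fzero    = refl
δ-sym (fsuc i) (fsuc j) = δ-sym i j

δ-< : ∀ {k} {i j : Fin k} → i <ᶠ j → δ i j ≡ false
δ-< {i = fzero}  {fsuc j} _         = refl
δ-< {i = fsuc i} {fsuc j} (s≤s i<j) = δ-< i<j

-- Vectors of length dbl k can be matched two entries at a time, unlike those of length 2 * k.
dbl : ℕ → ℕ
dbl zero    = zero
dbl (suc k) = suc (suc (dbl k))

dbl≡2* : ∀ r → dbl r ≡ 2 * r
dbl≡2* zero    = refl
dbl≡2* (suc r) = trans (cong (λ m → suc (suc m)) (dbl≡2* r)) (sym (*-suc 2 r))

-- The Arf invariant (true = elliptic) of the span of a symmetric family of 2k vectors on which
-- Q takes the value q: the first two vectors span a plane of type q, and shifting the others by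
-- their sum leaves a symmetric family of type not q orthogonal to that plane.
arf : Bool → ℕ → Bool
arf q zero    = false
arf q (suc k) = q xor arf (not q) k

arf-elliptic⇒rank≢0 : ∀ q k → arf q k ≡ true → k ≢ 0
arf-elliptic⇒rank≢0 q zero    ()
arf-elliptic⇒rank≢0 q (suc k) _ ()

module QuadraticSpace {n : ℕ} (Q : V n → Bool) (isQ : IsQuadraticForm Q) where

  B : V n → V n → Bool
  B = Bf Q

  B-⊕ˡ : ∀ u w v → B (u ⊕ w) v ≡ B u v xor B w v
  B-⊕ˡ = proj₁ (proj₂ isQ)

  B-•ˡ : ∀ a u v → B (a • u) v ≡ a ∧ B u v
  B-•ˡ = proj₁ (proj₂ (proj₂ isQ))

  B-⊕ʳ : ∀ u v w → B u (v ⊕ w) ≡ B u v xor B u w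
  B-⊕ʳ = proj₁ (proj₂ (proj₂ (proj₂ isQ)))

  Q-𝟘 : Q 𝟘 ≡ false
  Q-𝟘 = trans (cong Q (sym (•-zeroˡ 𝟘))) (proj₁ isQ false 𝟘)

  B-𝟘ˡ : ∀ v → B 𝟘 v ≡ false
  B-𝟘ˡ v = trans (cong (λ z → B z v) (sym (•-zeroˡ 𝟘))) (B-•ˡ false 𝟘 v)

  B-sym : ∀ u v → B u v ≡ B v u
  B-sym u v = begin
    (Q (u ⊕ v) xor Q u) xor Q v ≡⟨ cong (λ z → (Q z xor Q u) xor Q v) (⊕-comm u v) ⟩
    (Q (v ⊕ u) xor Q u) xor Q v
      ≡⟨ solve 3 (λ a b c → (a :+ b) :+ c := (a :+ c) :+ b) refl (Q (v ⊕ u)) (Q u) (Q v) ⟩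
    (Q (v ⊕ u) xor Q v) xor Q u ∎
    where open ≡-Reasoning

  B-𝟘ʳ : ∀ v → B v 𝟘 ≡ false
  B-𝟘ʳ v = trans (B-sym v 𝟘) (B-𝟘ˡ v)

  B-self : ∀ u → B u u ≡ false
  B-self u = begin
    (Q (u ⊕ u) xor Q u) xor Q u ≡⟨ cong (λ z → (Q z xor Q u) xor Q u) (⊕-self u) ⟩
    (Q 𝟘 xor Q u) xor Q u       ≡⟨ cong (λ z → (z xor Q u) xor Q u) Q-𝟘 ⟩
    Q u xor Q u                 ≡⟨ xor-same (Q u) ⟩
    false                       ∎
    where open ≡-Reasoning

  Q-⊕ : ∀ u v → Q (u ⊕ v) ≡ (Q u xor Q v) xor B u v
  Q-⊕ u v = solve 3 (λ s a b → s := (a :+ b) :+ ((s :+ a) :+ b)) refl (Q (u ⊕ v)) (Q u) (Q v)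

  Q-⊕≡ : ∀ {u v a b c} → Q u ≡ a → Q v ≡ b → B u v ≡ c → Q (u ⊕ v) ≡ (a xor b) xor c
  Q-⊕≡ {u} {v} refl refl refl = Q-⊕ u v

  B-⊕ˡ≡ : ∀ {u v w a b} → B u w ≡ a → B v w ≡ b → B (u ⊕ v) w ≡ a xor b
  B-⊕ˡ≡ {u} {v} {w} refl refl = B-⊕ˡ u v w

  B-⊕ʳ≡ : ∀ {u v w a b} → B u v ≡ a → B u w ≡ b → B u (v ⊕ w) ≡ a xor b
  B-⊕ʳ≡ {u} {v} {w} refl refl = B-⊕ʳ u v w

  B-sym≡ : ∀ {u v a} → B u v ≡ a → B v u ≡ a
  B-sym≡ {u} {v} = trans (B-sym v u)

  -- Orthogonality and spans

  _⊥_ : V n → V n → Set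
  u ⊥ v = B u v ≡ false

  _⊥*_ : ∀ {k m} → Vec (V n) k → Vec (V n) m → Set
  X ⊥* Y = ∀ {x y} → x ∈ X → y ∈ Y → x ⊥ y

  ⊥*-sym : ∀ {k m} {X : Vec (V n) k} {Y : Vec (V n) m} → X ⊥* Y → Y ⊥* X
  ⊥*-sym X⊥Y y∈Y x∈X = B-sym≡ (X⊥Y x∈X y∈Y)

  ⊥*-++ˡ : ∀ {k l m} (X : Vec (V n) k) {Y : Vec (V n) l} {Z : Vec (V n) m} →
    X ⊥* Z → Y ⊥* Z → (X ++ Y) ⊥* Z
  ⊥*-++ˡ X X⊥Z Y⊥Z v∈ z∈Z with ++⁻ X v∈
  ... | inj₁ v∈X = X⊥Z v∈X z∈Z
  ... | inj₂ v∈Y = Y⊥Z v∈Y z∈Z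

  ⊥*-++ʳ : ∀ {k l m} {X : Vec (V n) k} (Y : Vec (V n) l) {Z : Vec (V n) m} →
    X ⊥* Y → X ⊥* Z → X ⊥* (Y ++ Z)
  ⊥*-++ʳ Y X⊥Y X⊥Z = ⊥*-sym (⊥*-++ˡ Y (⊥*-sym X⊥Y) (⊥*-sym X⊥Z))

  data Span {m} (X : Vec (V n) m) : V n → Set where
    span-∈ : ∀ {v} → v ∈ X → Span X v
    span-𝟘 : Span X 𝟘
    span-⊕ : ∀ {u v} → Span X u → Span X v → Span X (u ⊕ v)

  span-cancelʳ : ∀ {m} {X : Vec (V n) m} {u v} → Span X (u ⊕ v) → Span X v → Span X u
  span-cancelʳ {u = u} {v} u⊕v v′ = subst (Span _) (⊕-cancelʳ u v) (span-⊕ u⊕v v′)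

  span-⊥ : ∀ {m} {Y : Vec (V n) m} {x} → (∀ {y} → y ∈ Y → x ⊥ y) → ∀ {v} → Span Y v → x ⊥ v
  span-⊥ x⊥Y (span-∈ v∈Y)   = x⊥Y v∈Y
  span-⊥ x⊥Y span-𝟘         = B-𝟘ʳ _
  span-⊥ x⊥Y (span-⊕ su sv) = B-⊕ʳ≡ (span-⊥ x⊥Y su) (span-⊥ x⊥Y sv)

  infix 4 _⊆⟨_⟩
  _⊆⟨_⟩ : ∀ {k m} → Vec (V n) k → Vec (V n) m → Set
  Y ⊆⟨ X ⟩ = ∀ {v} → v ∈ Y → Span X v

  ∈⇒⊆⟨⟩ : ∀ {k m} {Y : Vec (V n) k} {X : Vec (V n) m} → (∀ {v} → v ∈ Y → v ∈ X) → Y ⊆⟨ X ⟩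
  ∈⇒⊆⟨⟩ Y⊆X v∈Y = span-∈ (Y⊆X v∈Y)

  span-⊆⟨⟩ : ∀ {k m} {Y : Vec (V n) k} {X : Vec (V n) m} → Y ⊆⟨ X ⟩ → ∀ {v} → Span Y v → Span X v
  span-⊆⟨⟩ Y⊆X (span-∈ v∈Y)   = Y⊆X v∈Y
  span-⊆⟨⟩ Y⊆X span-𝟘         = span-𝟘
  span-⊆⟨⟩ Y⊆X (span-⊕ su sv) = span-⊕ (span-⊆⟨⟩ Y⊆X su) (span-⊆⟨⟩ Y⊆X sv)

  ⊆⟨⟩-trans : ∀ {k l m} {Z : Vec (V n) k} {Y : Vec (V n) l} {X : Vec (V n) m} →
    Z ⊆⟨ Y ⟩ → Y ⊆⟨ X ⟩ → Z ⊆⟨ X ⟩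
  ⊆⟨⟩-trans Z⊆Y Y⊆X v∈Z = span-⊆⟨⟩ Y⊆X (Z⊆Y v∈Z)

  ⊆⟨⟩-++ : ∀ {k l m} (Y : Vec (V n) k) {Z : Vec (V n) l} {X : Vec (V n) m} →
    Y ⊆⟨ X ⟩ → Z ⊆⟨ X ⟩ → Y ++ Z ⊆⟨ X ⟩
  ⊆⟨⟩-++ Y Y⊆X Z⊆X v∈ with ++⁻ Y v∈
  ... | inj₁ v∈Y = Y⊆X v∈Y
  ... | inj₂ v∈Z = Z⊆X v∈Z

  ⊥*-⊆⟨⟩ʳ : ∀ {k l m} {X : Vec (V n) k} {Y : Vec (V n) l} {Z : Vec (V n) m} →
    X ⊥* Y → Z ⊆⟨ Y ⟩ → X ⊥* Z
  ⊥*-⊆⟨⟩ʳ X⊥Y Z⊆Y x∈X z∈Z = span-⊥ (X⊥Y x∈X) (Z⊆Y z∈Z)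

  ⊥*-⊆⟨⟩ˡ : ∀ {k l m} {X : Vec (V n) k} {Y : Vec (V n) l} {Z : Vec (V n) m} →
    X ⊥* Y → Z ⊆⟨ X ⟩ → Z ⊥* Y
  ⊥*-⊆⟨⟩ˡ X⊥Y Z⊆X = ⊥*-sym (⊥*-⊆⟨⟩ʳ (⊥*-sym X⊥Y) Z⊆X)

  SameSpan : ∀ {k m} → Vec (V n) k → Vec (V n) m → Set
  SameSpan X Y = X ⊆⟨ Y ⟩ × Y ⊆⟨ X ⟩

  SameSpan-refl : ∀ {m} {X : Vec (V n) m} → SameSpan X X
  SameSpan-refl = span-∈ , span-∈

  SameSpan-sym : ∀ {k m} {X : Vec (V n) k} {Y : Vec (V n) m} → SameSpan X Y → SameSpan Y X
  SameSpan-sym (X⊆Y , Y⊆X) = Y⊆X , X⊆Y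

  SameSpan-trans : ∀ {k l m} {X : Vec (V n) k} {Y : Vec (V n) l} {Z : Vec (V n) m} →
    SameSpan X Y → SameSpan Y Z → SameSpan X Z
  SameSpan-trans (X⊆Y , Y⊆X) (Y⊆Z , Z⊆Y) = ⊆⟨⟩-trans X⊆Y Y⊆Z , ⊆⟨⟩-trans Z⊆Y Y⊆X

  SameSpan-++ : ∀ {k k′ l l′} {X : Vec (V n) k} {X′ : Vec (V n) k′} {Z : Vec (V n) l} {Z′ : Vec (V n) l′} →
    SameSpan X X′ → SameSpan Z Z′ → SameSpan (X ++ Z) (X′ ++ Z′)
  SameSpan-++ {X = X} {X′} (X⊆X′ , X′⊆X) (Z⊆Z′ , Z′⊆Z) =
    extend X X′ X⊆X′ Z⊆Z′ , extend X′ X X′⊆X Z′⊆Z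
    where
      extend : ∀ {k k′ l l′} (Y : Vec (V n) k) (Y′ : Vec (V n) k′) {W : Vec (V n) l} {W′ : Vec (V n) l′} →
        Y ⊆⟨ Y′ ⟩ → W ⊆⟨ W′ ⟩ → Y ++ W ⊆⟨ Y′ ++ W′ ⟩
      extend Y Y′ Y⊆Y′ W⊆W′ =
        ⊆⟨⟩-++ Y (⊆⟨⟩-trans Y⊆Y′ (∈⇒⊆⟨⟩ ∈-++⁺ˡ)) (⊆⟨⟩-trans W⊆W′ (∈⇒⊆⟨⟩ (∈-++⁺ʳ Y′)))

  sameMembers⇒SameSpan : ∀ {k m} {X : Vec (V n) k} {Y : Vec (V n) m} →
    (∀ {v} → v ∈ X → v ∈ Y) → (∀ {v} → v ∈ Y → v ∈ X) → SameSpan X Y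
  sameMembers⇒SameSpan X⊆Y Y⊆X = ∈⇒⊆⟨⟩ X⊆Y , ∈⇒⊆⟨⟩ Y⊆X

  SameSpan-interleave : ∀ {k l} a b (e : Vec (V n) k) (g : Vec (V n) l) →
    SameSpan ((a ∷ e) ++ (b ∷ g)) (a ∷ b ∷ (e ++ g))
  SameSpan-interleave a b e g = sameMembers⇒SameSpan
    (λ { (here v≡a) → here v≡a ; (there v∈) → there (∈-shift e v∈) })
    (λ { (here v≡a) → here v≡a ; (there v∈) → there (∈-unshift e v∈) })

  SameSpan-rotate : ∀ {k l m} (X : Vec (V n) k) (Y : Vec (V n) l) (Z : Vec (V n) m) →
    SameSpan (X ++ (Y ++ Z)) (Z ++ (X ++ Y))
  SameSpan-rotate X Y Z = sameMembers⇒SameSpan (∈-rotate X Y) (∈-unrotate X Y Z)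

  Independent : ∀ {m} → Vec (V n) m → Set
  Independent {m} X = ∀ c → lincomb c X ≡ 𝟘 → c ≡ replicate m false

  Spanning : ∀ {m} → Vec (V n) m → Set
  Spanning X = ∀ v → ∃[ c ] lincomb c X ≡ v

  span-• : ∀ {m} {X : Vec (V n) m} a {v} → Span X v → Span X (a • v)
  span-• false {v} _  = subst (Span _) (sym (•-zeroˡ v)) span-𝟘
  span-• true  {v} sv = subst (Span _) (sym (•-identityˡ v)) sv

  lincomb∈span : ∀ {m} (c : Vec Bool m) (X : Vec (V n) m) → Span X (lincomb c X)
  lincomb∈span []      []      = span-𝟘
  lincomb∈span (a ∷ c) (x ∷ X) =
    span-⊕ (span-• a (span-∈ (here refl))) (span-⊆⟨⟩ (∈⇒⊆⟨⟩ there) (lincomb∈span c X))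

  member⇒lincomb : ∀ {m} (X : Vec (V n) m) {v} → v ∈ X → ∃[ c ] lincomb c X ≡ v
  member⇒lincomb (x ∷ X) (here refl) =
    true ∷ replicate _ false , trans (cong₂ _⊕_ (•-identityˡ x) (lincomb-zero X)) (⊕-identityʳ x)
  member⇒lincomb (x ∷ X) (there v∈X) with member⇒lincomb X v∈X
  ... | c , refl = false ∷ c , trans (cong (_⊕ lincomb c X) (•-zeroˡ x)) (⊕-identityˡ _)

  span⇒lincomb : ∀ {m} {X : Vec (V n) m} {v} → Span X v → ∃[ c ] lincomb c X ≡ v
  span⇒lincomb (span-∈ v∈X) = member⇒lincomb _ v∈X
  span⇒lincomb {X = X} span-𝟘 = replicate _ false , lincomb-zero X
  span⇒lincomb {X = X} (span-⊕ su sv) with span⇒lincomb su | span⇒lincomb sv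
  ... | c , refl | d , refl = c ⊕ d , lincomb-⊕ c d X

  spanning-⊆⟨⟩ : ∀ {k m} {Y : Vec (V n) k} {X : Vec (V n) m} → Spanning Y → Y ⊆⟨ X ⟩ → Spanning X
  spanning-⊆⟨⟩ {Y = Y} spans Y⊆X v with spans v
  ... | c , refl = span⇒lincomb (span-⊆⟨⟩ Y⊆X (lincomb∈span c Y))

  lookup⇒⊥* : ∀ {k m} (X : Vec (V n) k) (Y : Vec (V n) m) →
    (∀ i j → lookup X i ⊥ lookup Y j) → X ⊥* Y
  lookup⇒⊥* X Y h x∈X =
    lookup⇒∈ {P = λ x → ∀ {y} → y ∈ Y → x ⊥ y} X (λ i → lookup⇒∈ {P = lookup X i ⊥_} Y (h i)) x∈X

  B-lincomb-⊥ : ∀ {m} (c : Vec Bool m) (X : Vec (V n) m) {w} →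
    (∀ {x} → x ∈ X → x ⊥ w) → lincomb c X ⊥ w
  B-lincomb-⊥ c X X⊥w = B-sym≡ (span-⊥ (λ x∈X → B-sym≡ (X⊥w x∈X)) (lincomb∈span c X))

  B-lincomb-δ : ∀ {m} (c : Vec Bool m) (X : Vec (V n) m) {w} j →
    (∀ i → B (lookup X i) w ≡ δ i j) → B (lincomb c X) w ≡ lookup c j
  B-lincomb-δ (a ∷ c) (x ∷ X) {w} fzero h =
    trans (B-⊕ˡ≡ (trans (B-•ˡ a x w) (cong (a ∧_) (h fzero)))
                 (B-lincomb-⊥ c X (lookup⇒∈ {P = _⊥ w} X (λ i → h (fsuc i)))))
          (trans (xor-identityʳ _) (∧-identityʳ a))
  B-lincomb-δ (a ∷ c) (x ∷ X) {w} (fsuc j) h =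
    trans (B-⊕ˡ≡ (trans (B-•ˡ a x w) (cong (a ∧_) (h fzero))) (B-lincomb-δ c X j (λ i → h (fsuc i))))
          (cong (_xor lookup c j) (∧-zeroʳ a))

  B-𝟘≡ : ∀ {v} w → v ≡ 𝟘 → B v w ≡ false
  B-𝟘≡ w refl = B-𝟘ˡ w

  lookup-false⇒replicate : ∀ {m} (c : Vec Bool m) → (∀ j → lookup c j ≡ false) → c ≡ replicate m false
  lookup-false⇒replicate []      _ = refl
  lookup-false⇒replicate (a ∷ c) h = cong₂ _∷_ (h fzero) (lookup-false⇒replicate c (λ j → h (fsuc j)))

  Dual : ∀ {m} → Vec (V n) m → Vec (V n) m → Set
  Dual X X* = ∀ i j → B (lookup X i) (lookup X* j) ≡ δ i j

  Dual-sym : ∀ {m} (X X* : Vec (V n) m) → Dual X X* → Dual X* X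
  Dual-sym _ _ dual i j = trans (B-sym≡ (dual j i)) (δ-sym j i)

  dual⇒independent : ∀ {m} {X : Vec (V n) m} (X* : Vec (V n) m) → Dual X X* → Independent X
  dual⇒independent {X = X} X* dual c lc≡𝟘 = lookup-false⇒replicate c λ j →
    trans (sym (B-lincomb-δ c X j (λ i → dual i j))) (B-𝟘≡ (lookup X* j) lc≡𝟘)

  -- Pairing with X* recovers the X-coefficients, after which Y is on its own.
  independent-++ : ∀ {k l} {X : Vec (V n) k} {Y : Vec (V n) l} (X* : Vec (V n) k) →
    Dual X X* → Y ⊥* X* → Independent Y → Independent (X ++ Y)
  independent-++ {k} {l} {X} {Y} X* dual Y⊥X* independentY c lc≡𝟘 with splitAt k c
  ... | c₁ , c₂ , refl = begin
    c₁ ++ c₂                                 ≡⟨ cong₂ _++_ c₁≡0 (independentY c₂ lincombY≡𝟘) ⟩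
    replicate k false ++ replicate l false   ≡⟨ replicate-++ k ⟩
    replicate (k + l) false                  ∎
    where
      open ≡-Reasoning
      split≡𝟘 : lincomb c₁ X ⊕ lincomb c₂ Y ≡ 𝟘
      split≡𝟘 = trans (sym (lincomb-++ c₁ c₂ X Y)) lc≡𝟘
      c₁≡0 : c₁ ≡ replicate k false
      c₁≡0 = lookup-false⇒replicate c₁ λ j → trans (sym (xor-identityʳ _))
        (trans (sym (B-⊕ˡ≡ (B-lincomb-δ c₁ X j (λ i → dual i j))
                           (B-lincomb-⊥ c₂ Y (λ y∈Y → Y⊥X* y∈Y (∈-lookup j X*)))))
               (B-𝟘≡ (lookup X* j) split≡𝟘))
      lincombX≡𝟘 : lincomb c₁ X ≡ 𝟘
      lincombX≡𝟘 = trans (cong (λ c → lincomb c X) c₁≡0) (lincomb-zero X)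
      lincombY≡𝟘 : lincomb c₂ Y ≡ 𝟘
      lincombY≡𝟘 = begin
        lincomb c₂ Y                   ≡⟨ sym (⊕-identityˡ _) ⟩
        𝟘 ⊕ lincomb c₂ Y               ≡⟨ cong (_⊕ lincomb c₂ Y) (sym lincombX≡𝟘) ⟩
        lincomb c₁ X ⊕ lincomb c₂ Y    ≡⟨ split≡𝟘 ⟩
        𝟘                              ∎
      replicate-++ : ∀ k → replicate k false ++ replicate l false ≡ replicate (k + l) false
      replicate-++ zero    = refl
      replicate-++ (suc k) = cong (false ∷_) (replicate-++ k)

  -- Planes

  record Plane (q : Bool) : Set where
    constructor plane
    field
      first second   : V n
      Q-first        : Q first ≡ q
      Q-second       : Q second ≡ q
      B-first-second : B first second ≡ true

    vectors : Vec (V n) 2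
    vectors = first ∷ second ∷ []

    sum : V n
    sum = first ⊕ second

  open Plane

  Q-sum : ∀ {q} (p : Plane q) → Q (sum p) ≡ true
  Q-sum {q} p = trans (Q-⊕≡ (Q-first p) (Q-second p) (B-first-second p))
                      (cong (_xor true) (xor-same q))

  B-sum : ∀ {q} (p : Plane q) {x} → x ∈ vectors p → B x (sum p) ≡ true
  B-sum p (here refl)         = B-⊕ʳ≡ (B-self (first p)) (B-first-second p)
  B-sum p (there (here refl)) = B-⊕ʳ≡ (B-sym≡ (B-first-second p)) (B-self (second p))

  plane-dual : ∀ {q} (p : Plane q) → Dual (vectors p) (second p ∷ first p ∷ [])
  plane-dual p fzero        fzero        = B-first-second p
  plane-dual p fzero        (fsuc fzero) = B-self (first p)
  plane-dual p (fsuc fzero) fzero        = B-self (second p)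
  plane-dual p (fsuc fzero) (fsuc fzero) = B-sym≡ (B-first-second p)

  B-⊕-sum : ∀ {q} (p : Plane q) {x v c} → x ∈ vectors p → B x v ≡ c → B x (v ⊕ sum p) ≡ not c
  B-⊕-sum p {c = c} x∈p Bxv = trans (B-⊕ʳ≡ Bxv (B-sum p x∈p)) (xor-true c)

  B-sum-uniform : ∀ {q} (p : Plane q) {v c} → (∀ {x} → x ∈ vectors p → B x v ≡ c) → B v (sum p) ≡ false
  B-sum-uniform p {c = c} h =
    trans (B-⊕ʳ≡ (B-sym≡ (h (here refl))) (B-sym≡ (h (there (here refl))))) (xor-same c)

  Q-⊕-anisotropic : ∀ {v t q} → Q t ≡ true → Q v ≡ q → v ⊥ t → Q (v ⊕ t) ≡ not q
  Q-⊕-anisotropic {q = q} Qt Qv v⊥t = trans (Q-⊕≡ Qv Qt v⊥t) (trans (xor-identityʳ _) (xor-true q))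

  shift : ∀ {q} (p : Plane q) (t : V n) → Q t ≡ true → (∀ {x} → x ∈ vectors p → x ⊥ t) → Plane (not q)
  shift p t Qt p⊥t = record
    { first          = first p ⊕ t
    ; second         = second p ⊕ t
    ; Q-first        = Q-⊕-anisotropic Qt (Q-first p) (p⊥t (here refl))
    ; Q-second       = Q-⊕-anisotropic Qt (Q-second p) (p⊥t (there (here refl)))
    ; B-first-second = B-⊕ˡ≡ (B-⊕ʳ≡ (B-first-second p) (p⊥t (here refl)))
                             (B-⊕ʳ≡ (B-sym≡ (p⊥t (there (here refl)))) (B-self t))
    }

  sum-shift : ∀ {q} (p : Plane q) t Qt (p⊥t : ∀ {x} → x ∈ vectors p → x ⊥ t) →
    sum (shift p t Qt p⊥t) ≡ sum p
  sum-shift p t _ _ = begin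
    (first p ⊕ t) ⊕ (second p ⊕ t) ≡⟨ ⊕-interchange (first p) t (second p) t ⟩
    sum p ⊕ (t ⊕ t)                ≡⟨ cong (sum p ⊕_) (⊕-self t) ⟩
    sum p ⊕ 𝟘                      ≡⟨ ⊕-identityʳ (sum p) ⟩
    sum p                          ∎
    where open ≡-Reasoning

  span-sum : ∀ {q m} (p : Plane q) {W : Vec (V n) m} → vectors p ⊆⟨ W ⟩ → Span W (sum p)
  span-sum p p⊆W = span-⊕ (p⊆W (here refl)) (p⊆W (there (here refl)))

  ⊕-⊆⟨⟩ : ∀ {k m t} {X : Vec (V n) k} {W : Vec (V n) m} → Span W t → X ⊆⟨ W ⟩ → map (_⊕ t) X ⊆⟨ W ⟩
  ⊕-⊆⟨⟩ {t = t} {X} tW X⊆W = ∀∈-map (_⊕ t) X (λ x∈X → span-⊕ (X⊆W x∈X) tW)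

  ⊕⁻¹-⊆⟨⟩ : ∀ {k m t} {X : Vec (V n) k} {W : Vec (V n) m} → Span W t → map (_⊕ t) X ⊆⟨ W ⟩ → X ⊆⟨ W ⟩
  ⊕⁻¹-⊆⟨⟩ {t = t} tW X⊆W x∈X = span-cancelʳ (X⊆W (∈-map⁺ (_⊕ t) x∈X)) tW

  -- Shift each plane by the sum of the other.
  exchange : ∀ {q} (p p′ : Plane q) → vectors p ⊥* vectors p′ →
    Σ (Plane (not q)) λ h → Σ (Plane (not q)) λ h′ →
      vectors h ⊥* vectors h′ × SameSpan (vectors h ++ vectors h′) (vectors p ++ vectors p′)
  exchange p p′ p⊥p′ = h , h′ , h⊥h′ , new⊆old , old⊆new
    where
      p⊥sum : ∀ {x} → x ∈ vectors p → x ⊥ sum p′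
      p⊥sum x∈p = B-⊕ʳ≡ (p⊥p′ x∈p (here refl)) (p⊥p′ x∈p (there (here refl)))
      p′⊥sum : ∀ {y} → y ∈ vectors p′ → y ⊥ sum p
      p′⊥sum y∈p′ = B-⊕ʳ≡ (B-sym≡ (p⊥p′ (here refl) y∈p′)) (B-sym≡ (p⊥p′ (there (here refl)) y∈p′))
      h  = shift p (sum p′) (Q-sum p′) p⊥sum
      h′ = shift p′ (sum p) (Q-sum p) p′⊥sum
      h⊥h′ : vectors h ⊥* vectors h′
      h⊥h′ u∈h w∈h′ =
        ∀∈-map {P = λ u → ∀ {w} → w ∈ vectors h′ → u ⊥ w} (_⊕ sum p′) (vectors p) (λ x∈p →
          ∀∈-map (_⊕ sum p) (vectors p′) λ y∈p′ →
            B-⊕ˡ≡ (B-⊕ʳ≡ (p⊥p′ x∈p y∈p′) (B-sum p x∈p))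
                  (B-⊕ʳ≡ (B-sym≡ (B-sum p′ y∈p′))
                         (B-⊕ˡ≡ (p′⊥sum (here refl)) (p′⊥sum (there (here refl))))))
          u∈h w∈h′
      new⊆old : vectors h ++ vectors h′ ⊆⟨ vectors p ++ vectors p′ ⟩
      new⊆old = ⊆⟨⟩-++ (vectors h)
        (⊕-⊆⟨⟩ (span-sum p′ (∈⇒⊆⟨⟩ (∈-++⁺ʳ (vectors p)))) (∈⇒⊆⟨⟩ ∈-++⁺ˡ))
        (⊕-⊆⟨⟩ (span-sum p (∈⇒⊆⟨⟩ ∈-++⁺ˡ)) (∈⇒⊆⟨⟩ (∈-++⁺ʳ (vectors p))))
      old⊆new : vectors p ++ vectors p′ ⊆⟨ vectors h ++ vectors h′ ⟩
      old⊆new = ⊆⟨⟩-++ (vectors p)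
        (⊕⁻¹-⊆⟨⟩ sum-p′∈new (∈⇒⊆⟨⟩ ∈-++⁺ˡ)) (⊕⁻¹-⊆⟨⟩ sum-p∈new (∈⇒⊆⟨⟩ (∈-++⁺ʳ (vectors h))))
        where
          sum-p∈new : Span (vectors h ++ vectors h′) (sum p)
          sum-p∈new = subst (Span _) (sum-shift p (sum p′) (Q-sum p′) p⊥sum) (span-sum h (∈⇒⊆⟨⟩ ∈-++⁺ˡ))
          sum-p′∈new : Span (vectors h ++ vectors h′) (sum p′)
          sum-p′∈new = subst (Span _) (sum-shift p′ (sum p) (Q-sum p) p′⊥sum)
                             (span-sum h′ (∈⇒⊆⟨⟩ (∈-++⁺ʳ (vectors h))))

  -- Symmetric families

  SameSpan-⊕ : ∀ {k m t} (X : Vec (V n) k) {W : Vec (V n) m} → Span X t →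
    SameSpan (X ++ map (_⊕ t) W) (X ++ W)
  SameSpan-⊕ X {W} tX =
    ⊆⟨⟩-++ X (∈⇒⊆⟨⟩ ∈-++⁺ˡ) (⊕-⊆⟨⟩ t∈ (∈⇒⊆⟨⟩ (∈-++⁺ʳ X))) ,
    ⊆⟨⟩-++ X (∈⇒⊆⟨⟩ ∈-++⁺ˡ) (⊕⁻¹-⊆⟨⟩ t∈ (∈⇒⊆⟨⟩ (∈-++⁺ʳ X)))
    where
      t∈ : ∀ {l} {Z : Vec (V n) l} → Span (X ++ Z) _
      t∈ = span-⊆⟨⟩ (∈⇒⊆⟨⟩ ∈-++⁺ˡ) tX

  Symmetric : Bool → ∀ {m} → Vec (V n) m → Set
  Symmetric q []       = ⊤
  Symmetric q (w ∷ ws) = Q w ≡ q × (∀ {v} → v ∈ ws → B w v ≡ true) × Symmetric q ws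

  symmetric-shift : ∀ {q q′ c m} (p : Plane q′) {ws : Vec (V n) m} →
    (∀ {x v} → x ∈ vectors p → v ∈ ws → B x v ≡ c) → Symmetric q ws →
    Symmetric (not q) (map (_⊕ sum p) ws)
  symmetric-shift p {[]}     _       _                  = tt
  symmetric-shift p {w ∷ ws} uniform (Qw , w∼ws , ws∼) =
    Q-⊕-anisotropic (Q-sum p) Qw (w⊥sum (here refl)) ,
    ∀∈-map (_⊕ sum p) ws (λ v∈ws →
      B-⊕ˡ≡ (B-⊕ʳ≡ (w∼ws v∈ws) (w⊥sum (here refl)))
            (B-⊕ʳ≡ (B-sym≡ (w⊥sum (there v∈ws))) (B-self (sum p)))) ,
    symmetric-shift p (λ x∈p v∈ws → uniform x∈p (there v∈ws)) ws∼
    where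
      w⊥sum : ∀ {v} → v ∈ w ∷ ws → v ⊥ sum p
      w⊥sum v∈ = B-sum-uniform p (λ x∈p → uniform x∈p v∈)

  leadingPlane : ∀ {q m w₁ w₂} {ws : Vec (V n) m} → Symmetric q (w₁ ∷ w₂ ∷ ws) → Plane q
  leadingPlane (Q₁ , w₁∼ , Q₂ , _) = plane _ _ Q₁ Q₂ (w₁∼ (here refl))

  symmetric-split : ∀ {q m w₁ w₂} {ws : Vec (V n) m} (s : Symmetric q (w₁ ∷ w₂ ∷ ws)) →
    let p = leadingPlane s in
    Symmetric (not q) (map (_⊕ sum p) ws) × vectors p ⊥* map (_⊕ sum p) ws
  symmetric-split {ws = ws} s@(_ , w₁∼ , _ , w₂∼ , ws∼) =
    symmetric-shift p uniform ws∼ ,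
    λ x∈p → ∀∈-map (_⊕ sum p) ws (λ v∈ws → B-⊕-sum p x∈p (uniform x∈p v∈ws))
    where
      p = leadingPlane s
      uniform : ∀ {x v} → x ∈ vectors p → v ∈ ws → B x v ≡ true
      uniform (here refl)         v∈ws = w₁∼ (there v∈ws)
      uniform (there (here refl)) v∈ws = w₂∼ v∈ws

  symmetric-join : ∀ {q m} (p : Plane q) {ws : Vec (V n) m} → vectors p ⊥* ws → Symmetric (not q) ws →
    Symmetric q (first p ∷ second p ∷ map (_⊕ sum p) ws)
  symmetric-join {q} p {ws} p⊥ws ws∼ =
    Q-first p ,
    (λ { (here refl) → B-first-second p ; (there v∈) → joined (here refl) v∈ }) ,
    Q-second p ,
    joined (there (here refl)) ,
    subst (λ q → Symmetric q (map (_⊕ sum p) ws)) (not-involutive q) (symmetric-shift p p⊥ws ws∼)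
    where
      joined : ∀ {x} → x ∈ vectors p → ∀ {v} → v ∈ map (_⊕ sum p) ws → B x v ≡ true
      joined x∈p = ∀∈-map (_⊕ sum p) ws (λ v∈ws → B-⊕-sum p x∈p (p⊥ws x∈p v∈ws))

  -- Decompositions into orthogonal planes

  hypPairs-[] : HypPairs Q [] []
  hypPairs-[] = (λ ()) , (λ ()) , (λ ()) , (λ ()) , (λ ())

  gram-cons : ∀ {k x} {X : Vec (V n) k} → (∀ i → x ⊥ lookup X i) →
    (∀ i j → lookup X i ⊥ lookup X j) → ∀ i j → lookup (x ∷ X) i ⊥ lookup (x ∷ X) j
  gram-cons {x = x} x⊥X X⊥X fzero    fzero    = B-self x
  gram-cons         x⊥X X⊥X fzero    (fsuc j) = x⊥X j
  gram-cons         x⊥X X⊥X (fsuc i) fzero    = B-sym≡ (x⊥X i)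
  gram-cons         x⊥X X⊥X (fsuc i) (fsuc j) = X⊥X i j

  hypPairs-cons : ∀ {k} (p : Plane false) {e f : Vec (V n) k} → vectors p ⊥* (e ++ f) →
    HypPairs Q e f → HypPairs Q (first p ∷ e) (second p ∷ f)
  hypPairs-cons p {e} {f} p⊥ef (Q-e , Q-f , B-ef , B-ee , B-ff) =
    Q-e′ , Q-f′ , B-ef′ , gram-cons (⊥e (here refl)) B-ee , gram-cons (⊥f (there (here refl))) B-ff
    where
      ⊥e : ∀ {x} → x ∈ vectors p → ∀ i → x ⊥ lookup e i
      ⊥e x∈p i = p⊥ef x∈p (∈-++⁺ˡ (∈-lookup i e))
      ⊥f : ∀ {x} → x ∈ vectors p → ∀ i → x ⊥ lookup f i
      ⊥f x∈p i = p⊥ef x∈p (∈-++⁺ʳ e (∈-lookup i f))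
      Q-e′ : ∀ i → Q (lookup (first p ∷ e) i) ≡ false
      Q-e′ fzero    = Q-first p
      Q-e′ (fsuc i) = Q-e i
      Q-f′ : ∀ i → Q (lookup (second p ∷ f) i) ≡ false
      Q-f′ fzero    = Q-second p
      Q-f′ (fsuc i) = Q-f i
      B-ef′ : ∀ i j → B (lookup (first p ∷ e) i) (lookup (second p ∷ f) j) ≡ δ i j
      B-ef′ fzero    fzero    = B-first-second p
      B-ef′ fzero    (fsuc j) = ⊥f (here refl) j
      B-ef′ (fsuc i) fzero    = B-sym≡ (⊥e (there (here refl)) i)
      B-ef′ (fsuc i) (fsuc j) = B-ef i j

  module _ {k a b} {e f : Vec (V n) k} (hp : HypPairs Q (a ∷ e) (b ∷ f)) where
    private
      Q-e = proj₁ hp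
      Q-f = proj₁ (proj₂ hp)
      B-ef = proj₁ (proj₂ (proj₂ hp))
      B-ee = proj₁ (proj₂ (proj₂ (proj₂ hp)))
      B-ff = proj₂ (proj₂ (proj₂ (proj₂ hp)))

    hypPairs-head : Plane false
    hypPairs-head = plane a b (Q-e fzero) (Q-f fzero) (B-ef fzero fzero)

    hypPairs-tail : HypPairs Q e f
    hypPairs-tail = (λ i → Q-e (fsuc i)) , (λ i → Q-f (fsuc i)) , (λ i j → B-ef (fsuc i) (fsuc j)) ,
                    (λ i j → B-ee (fsuc i) (fsuc j)) , (λ i j → B-ff (fsuc i) (fsuc j))

    hypPairs-head-⊥ : vectors hypPairs-head ⊥* (e ++ f)
    hypPairs-head-⊥ = ⊥*-++ʳ e
      (lookup⇒⊥* (a ∷ b ∷ []) e λ { fzero        j → B-ee fzero (fsuc j)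
                                   ; (fsuc fzero) j → B-sym≡ (B-ef (fsuc j) fzero) })
      (lookup⇒⊥* (a ∷ b ∷ []) f λ { fzero        j → B-ef fzero (fsuc j)
                                   ; (fsuc fzero) j → B-ff fzero (fsuc j) })

  -- Decomposition Y a k: a family with the same span as Y and of the shape required by
  -- Hyperbolic k Q (a = false) or Elliptic k Q (a = true), independence aside.
  data Decomposition {m} (Y : Vec (V n) m) : Bool → ℕ → Set where
    hyperbolic : ∀ {k} (e f : Vec (V n) k) → HypPairs Q e f → SameSpan (e ++ f) Y →
      Decomposition Y false k
    elliptic : ∀ {k} (e f : Vec (V n) k) (p : Plane true) → HypPairs Q e f → (e ++ f) ⊥* vectors p →
      SameSpan (e ++ f ++ vectors p) Y → Decomposition Y true (suc k)

  decomposition-resp : ∀ {a k m m′} {Y : Vec (V n) m} {Y′ : Vec (V n) m′} →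
    SameSpan Y Y′ → Decomposition Y a k → Decomposition Y′ a k
  decomposition-resp Y≈Y′ (hyperbolic e f hp ss)       = hyperbolic e f hp (SameSpan-trans ss Y≈Y′)
  decomposition-resp Y≈Y′ (elliptic e f p hp ef⊥p ss) = elliptic e f p hp ef⊥p (SameSpan-trans ss Y≈Y′)

  ⊥*-elliptic : ∀ {k l} (e f : Vec (V n) k) (x : Plane true) {X : Vec (V n) l} →
    X ⊥* (e ++ f ++ vectors x) → X ⊥* (e ++ f) × X ⊥* vectors x
  ⊥*-elliptic e f x X⊥efx =
    (λ u∈X w∈ef → X⊥efx u∈X (∈-unrotate e f (vectors x) (∈-++⁺ʳ (vectors x) w∈ef))) ,
    (λ u∈X w∈x → X⊥efx u∈X (∈-++⁺ʳ e (∈-++⁺ʳ f w∈x)))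

  ellipticPair⇒hyperbolic : ∀ {k} (p x : Plane true) (e f : Vec (V n) k) → HypPairs Q e f →
    vectors p ⊥* (e ++ f) → (e ++ f) ⊥* vectors x → vectors p ⊥* vectors x →
    Decomposition (vectors p ++ (e ++ f ++ vectors x)) false (suc (suc k))
  ellipticPair⇒hyperbolic {k} p x e f hp p⊥ef ef⊥x p⊥x = merge (exchange p x p⊥x)
    where
      merge : (Σ (Plane false) λ h → Σ (Plane false) λ h′ →
                vectors h ⊥* vectors h′ × SameSpan (vectors h ++ vectors h′) (vectors p ++ vectors x)) →
              Decomposition (vectors p ++ (e ++ f ++ vectors x)) false (suc (suc k))
      merge (h , h′ , h⊥h′ , hh′≈px) =
        hyperbolic (first h ∷ first h′ ∷ e) (second h ∷ second h′ ∷ f)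
          (hypPairs-cons h h⊥rest (hypPairs-cons h′ h′⊥ef hp))
          (SameSpan-trans step₁ (SameSpan-trans step₂ (SameSpan-trans step₃ step₄)))
        where
          hh′⊥ef : (vectors h ++ vectors h′) ⊥* (e ++ f)
          hh′⊥ef = ⊥*-⊆⟨⟩ˡ (⊥*-++ˡ (vectors p) p⊥ef (⊥*-sym ef⊥x)) (proj₁ hh′≈px)
          h′⊥ef : vectors h′ ⊥* (e ++ f)
          h′⊥ef u∈h′ = hh′⊥ef (∈-++⁺ʳ (vectors h) u∈h′)
          h⊥rest : vectors h ⊥* ((first h′ ∷ e) ++ (second h′ ∷ f))
          h⊥rest = ⊥*-⊆⟨⟩ʳ (⊥*-++ʳ (vectors h′) h⊥h′ (λ u∈h → hh′⊥ef (∈-++⁺ˡ u∈h)))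
                           (proj₁ (SameSpan-interleave (first h′) (second h′) e f))
          step₁ : SameSpan ((first h ∷ first h′ ∷ e) ++ (second h ∷ second h′ ∷ f))
                           (vectors h ++ ((first h′ ∷ e) ++ (second h′ ∷ f)))
          step₁ = SameSpan-interleave (first h) (second h) (first h′ ∷ e) (second h′ ∷ f)
          step₂ : SameSpan (vectors h ++ ((first h′ ∷ e) ++ (second h′ ∷ f)))
                           ((vectors h ++ vectors h′) ++ (e ++ f))
          step₂ = SameSpan-++ (SameSpan-refl {X = vectors h}) (SameSpan-interleave (first h′) (second h′) e f)
          step₃ : SameSpan ((vectors h ++ vectors h′) ++ (e ++ f)) (vectors p ++ (vectors x ++ (e ++ f)))
          step₃ = SameSpan-++ hh′≈px (SameSpan-refl {X = e ++ f})
          step₄ : SameSpan (vectors p ++ (vectors x ++ (e ++ f))) (vectors p ++ (e ++ f ++ vectors x))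
          step₄ = SameSpan-++ (SameSpan-refl {X = vectors p}) (SameSpan-sym (SameSpan-rotate e f (vectors x)))

  addPlane : ∀ {q a k m} (p : Plane q) {Z : Vec (V n) m} → vectors p ⊥* Z → Decomposition Z a k →
    Decomposition (vectors p ++ Z) (q xor a) (suc k)
  addPlane {false} p p⊥Z (hyperbolic e f hp ss) =
    hyperbolic (first p ∷ e) (second p ∷ f) (hypPairs-cons p (⊥*-⊆⟨⟩ʳ p⊥Z (proj₁ ss)) hp)
      (SameSpan-trans (SameSpan-interleave _ _ e f) (SameSpan-++ SameSpan-refl ss))
  addPlane {false} p p⊥Z (elliptic e f x hp ef⊥x ss) =
    let (p⊥ef , p⊥x) = ⊥*-elliptic e f x (⊥*-⊆⟨⟩ʳ p⊥Z (proj₁ ss)) in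
    elliptic (first p ∷ e) (second p ∷ f) x (hypPairs-cons p p⊥ef hp)
      (⊥*-⊆⟨⟩ˡ (⊥*-++ˡ (vectors p) p⊥x ef⊥x) (proj₁ (SameSpan-interleave _ _ e f)))
      (SameSpan-trans (SameSpan-interleave _ _ e (f ++ vectors x)) (SameSpan-++ SameSpan-refl ss))
  addPlane {true} p p⊥Z (hyperbolic e f hp ss) =
    elliptic e f p hp (⊥*-sym (⊥*-⊆⟨⟩ʳ p⊥Z (proj₁ ss)))
      (SameSpan-trans (SameSpan-rotate e f (vectors p)) (SameSpan-++ SameSpan-refl ss))
  addPlane {true} p p⊥Z (elliptic e f x hp ef⊥x ss) =
    let (p⊥ef , p⊥x) = ⊥*-elliptic e f x (⊥*-⊆⟨⟩ʳ p⊥Z (proj₁ ss)) in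
    decomposition-resp {Y = vectors p ++ (e ++ f ++ vectors x)}
      (SameSpan-++ (SameSpan-refl {X = vectors p}) ss)
      (ellipticPair⇒hyperbolic p x e f hp p⊥ef ef⊥x p⊥x)

  record Splitting (q a : Bool) (k : ℕ) {m} (Y : Vec (V n) m) : Set where
    constructor splitting
    field
      {size}        : ℕ
      leading       : Plane q
      rest          : Vec (V n) size
      leading-⊥     : vectors leading ⊥* rest
      decomposition : Decomposition rest a k
      sameSpan      : SameSpan (vectors leading ++ rest) Y

  hyperbolicPair⇒splitting : ∀ {k m} (e f : Vec (V n) k) {Y : Vec (V n) m} {a a′ b b′} →
    HypPairs Q (a ∷ a′ ∷ e) (b ∷ b′ ∷ f) → SameSpan ((a ∷ a′ ∷ e) ++ (b ∷ b′ ∷ f)) Y →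
    Splitting true true (suc k) Y
  hyperbolicPair⇒splitting {k} e f {Y} hp ss = split (exchange h h′ h⊥h′)
    where
      h  = hypPairs-head hp
      h′ = hypPairs-head (hypPairs-tail hp)
      h⊥h′e′f′ : vectors h ⊥* (vectors h′ ++ (e ++ f))
      h⊥h′e′f′ = ⊥*-⊆⟨⟩ʳ (hypPairs-head-⊥ hp) (proj₂ (SameSpan-interleave (first h′) (second h′) e f))
      h⊥h′ : vectors h ⊥* vectors h′
      h⊥h′ u∈h w∈h′ = h⊥h′e′f′ u∈h (∈-++⁺ˡ w∈h′)
      hh′⊥ef : (vectors h ++ vectors h′) ⊥* (e ++ f)
      hh′⊥ef = ⊥*-++ˡ (vectors h) (λ u∈h w∈ef → h⊥h′e′f′ u∈h (∈-++⁺ʳ (vectors h′) w∈ef))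
                                  (hypPairs-head-⊥ (hypPairs-tail hp))
      split : (Σ (Plane true) λ p → Σ (Plane true) λ x →
                vectors p ⊥* vectors x × SameSpan (vectors p ++ vectors x) (vectors h ++ vectors h′)) →
              Splitting true true (suc k) Y
      split (p , x , p⊥x , px≈hh′) =
        splitting p (e ++ f ++ vectors x) p⊥rest
          (elliptic e f x (hypPairs-tail (hypPairs-tail hp)) (⊥*-sym (λ w∈x → px⊥ef (∈-++⁺ʳ (vectors p) w∈x)))
            SameSpan-refl)
          (SameSpan-trans step₁ (SameSpan-trans step₂ (SameSpan-trans step₃ (SameSpan-trans step₄ ss))))
        where
          px⊥ef : (vectors p ++ vectors x) ⊥* (e ++ f)
          px⊥ef = ⊥*-⊆⟨⟩ˡ hh′⊥ef (proj₁ px≈hh′)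
          p⊥rest : vectors p ⊥* (e ++ f ++ vectors x)
          p⊥rest = ⊥*-⊆⟨⟩ʳ (⊥*-++ʳ (vectors x) p⊥x (λ u∈p → px⊥ef (∈-++⁺ˡ u∈p))) (∈⇒⊆⟨⟩ (∈-rotate e f))
          step₁ : SameSpan (vectors p ++ (e ++ f ++ vectors x)) (vectors p ++ (vectors x ++ (e ++ f)))
          step₁ = SameSpan-++ (SameSpan-refl {X = vectors p}) (SameSpan-rotate e f (vectors x))
          step₂ : SameSpan (vectors p ++ (vectors x ++ (e ++ f))) ((vectors h ++ vectors h′) ++ (e ++ f))
          step₂ = SameSpan-++ px≈hh′ (SameSpan-refl {X = e ++ f})
          step₃ : SameSpan ((vectors h ++ vectors h′) ++ (e ++ f))
                           (vectors h ++ ((first h′ ∷ e) ++ (second h′ ∷ f)))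
          step₃ = SameSpan-++ (SameSpan-refl {X = vectors h})
                              (SameSpan-sym (SameSpan-interleave (first h′) (second h′) e f))
          step₄ : SameSpan (vectors h ++ ((first h′ ∷ e) ++ (second h′ ∷ f)))
                           ((first h ∷ first h′ ∷ e) ++ (second h ∷ second h′ ∷ f))
          step₄ = SameSpan-sym (SameSpan-interleave (first h) (second h) (first h′ ∷ e) (second h′ ∷ f))

  splitPlane : ∀ q {a k m} {Y : Vec (V n) m} → (a ≡ true → k ≢ 0) →
    Decomposition Y (q xor a) (suc k) → Splitting q a k Y
  splitPlane false _ (hyperbolic (a ∷ e) (b ∷ f) hp ss) =
    splitting (hypPairs-head hp) (e ++ f) (hypPairs-head-⊥ hp)
      (hyperbolic e f (hypPairs-tail hp) SameSpan-refl)
      (SameSpan-trans (SameSpan-sym (SameSpan-interleave a b e f)) ss)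
  splitPlane false rank≢0 (elliptic [] [] _ _ _ _) = ⊥-elim (rank≢0 refl refl)
  splitPlane false _ (elliptic (a ∷ e) (b ∷ f) x hp ef⊥x ss) =
    splitting (hypPairs-head hp) (e ++ f ++ vectors x)
      (⊥*-⊆⟨⟩ʳ (⊥*-++ʳ (vectors x) (λ u∈ab → abef⊥x (∈-++⁺ˡ u∈ab)) (hypPairs-head-⊥ hp))
               (∈⇒⊆⟨⟩ (∈-rotate e f)))
      (elliptic e f x (hypPairs-tail hp) (λ w∈ef → abef⊥x (∈-++⁺ʳ (a ∷ b ∷ []) w∈ef)) SameSpan-refl)
      (SameSpan-trans (SameSpan-sym (SameSpan-interleave a b e (f ++ vectors x))) ss)
    where
      abef⊥x : (a ∷ b ∷ (e ++ f)) ⊥* vectors x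
      abef⊥x = ⊥*-⊆⟨⟩ˡ ef⊥x (proj₂ (SameSpan-interleave a b e f))
  splitPlane true {false} _ (elliptic e f p hp ef⊥p ss) =
    splitting p (e ++ f) (⊥*-sym ef⊥p) (hyperbolic e f hp SameSpan-refl)
      (SameSpan-trans (SameSpan-sym (SameSpan-rotate e f (vectors p))) ss)
  splitPlane true {true} rank≢0 (hyperbolic (_ ∷ []) (_ ∷ []) _ _) = ⊥-elim (rank≢0 refl refl)
  splitPlane true {true} _ (hyperbolic (_ ∷ _ ∷ e) (_ ∷ _ ∷ f) hp ss) = hyperbolicPair⇒splitting e f hp ss

  symmetric⇒decomposition : ∀ k q (ws : Vec (V n) (dbl k)) → Symmetric q ws → Decomposition ws (arf q k) k
  symmetric⇒decomposition zero    q []             _ = hyperbolic [] [] hypPairs-[] SameSpan-refl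
  symmetric⇒decomposition (suc k) q (w₁ ∷ w₂ ∷ ws) s =
    decomposition-resp (SameSpan-⊕ (vectors p) (span-sum p span-∈))
      (addPlane p (proj₂ (symmetric-split s))
        (symmetric⇒decomposition k (not q) (map (_⊕ sum p) ws) (proj₁ (symmetric-split s))))
    where p = leadingPlane s

  decomposition⇒symmetric : ∀ k q {m} {Y : Vec (V n) m} → Decomposition Y (arf q k) k →
    Σ (Vec (V n) (dbl k)) λ ws → Symmetric q ws × SameSpan ws Y
  decomposition⇒symmetric zero    q (hyperbolic [] [] _ ss) = [] , tt , ss
  decomposition⇒symmetric (suc k) q D
    with splitting p Z p⊥Z D′ ss ← splitPlane q (arf-elliptic⇒rank≢0 (not q) k) D
    with ws , ws∼ , ws≈Z ← decomposition⇒symmetric k (not q) D′ =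
    first p ∷ second p ∷ map (_⊕ sum p) ws ,
    symmetric-join p (⊥*-⊆⟨⟩ʳ p⊥Z (proj₁ ws≈Z)) ws∼ ,
    SameSpan-trans (SameSpan-⊕ (vectors p) (span-sum p span-∈))
                   (SameSpan-trans (SameSpan-++ (SameSpan-refl {X = vectors p}) ws≈Z) ss)

  -- Bases

  hyperbolic⇒independent : ∀ {k} {e f : Vec (V n) k} → HypPairs Q e f → Independent (e ++ f)
  hyperbolic⇒independent {e = e} {f} (_ , _ , B-ef , _ , B-ff) =
    independent-++ {X = e} f B-ef (lookup⇒⊥* f f B-ff) (dual⇒independent e (Dual-sym e f B-ef))

  elliptic⇒independent : ∀ {k} {e f : Vec (V n) k} (p : Plane true) → HypPairs Q e f →
    (e ++ f) ⊥* vectors p → Independent (e ++ f ++ vectors p)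
  elliptic⇒independent {e = e} {f} p (_ , _ , B-ef , _ , B-ff) ef⊥p =
    independent-++ {X = e} f B-ef (⊥*-++ˡ f (lookup⇒⊥* f f B-ff) (⊥*-sym (λ w∈f → ef⊥p (∈-++⁺ʳ e w∈f))))
      (independent-++ {X = f} e (Dual-sym e f B-ef)
        (⊥*-sym (λ w∈e → ef⊥p (∈-++⁺ˡ w∈e)))
        (dual⇒independent (second p ∷ first p ∷ []) (plane-dual p)))

  sumᵛ : ∀ {m} → Vec (V n) m → V n
  sumᵛ []       = 𝟘
  sumᵛ (w ∷ ws) = w ⊕ sumᵛ ws

  B-sumᵛ-even : ∀ k {x} (ws : Vec (V n) (dbl k)) → (∀ {v} → v ∈ ws → B x v ≡ true) → x ⊥ sumᵛ ws
  B-sumᵛ-even zero    {x} []             _   = B-𝟘ʳ x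
  B-sumᵛ-even (suc k)     (w₁ ∷ w₂ ∷ ws) x∼ =
    B-⊕ʳ≡ (x∼ (here refl)) (B-⊕ʳ≡ (x∼ (there (here refl))) (B-sumᵛ-even k ws (λ v∈ → x∼ (there (there v∈)))))

  B-sumᵛ-symmetric : ∀ k {q} (ws : Vec (V n) (dbl k)) → Symmetric q ws →
    ∀ {w} → w ∈ ws → B w (sumᵛ ws) ≡ true
  B-sumᵛ-symmetric (suc k) (w₁ ∷ w₂ ∷ ws) (_ , w₁∼ , _ , w₂∼ , _) (here refl) =
    B-⊕ʳ≡ (B-self w₁) (B-⊕ʳ≡ (w₁∼ (here refl)) (B-sumᵛ-even k ws (λ v∈ → w₁∼ (there v∈))))
  B-sumᵛ-symmetric (suc k) (w₁ ∷ w₂ ∷ ws) (_ , w₁∼ , _ , w₂∼ , _) (there (here refl)) =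
    B-⊕ʳ≡ (B-sym≡ (w₁∼ (here refl))) (B-⊕ʳ≡ (B-self w₂) (B-sumᵛ-even k ws w₂∼))
  B-sumᵛ-symmetric (suc k) (w₁ ∷ w₂ ∷ ws) (_ , w₁∼ , _ , w₂∼ , ws∼) (there (there w∈)) =
    B-⊕ʳ≡ (B-sym≡ (w₁∼ (there w∈))) (B-⊕ʳ≡ (B-sym≡ (w₂∼ w∈)) (B-sumᵛ-symmetric k ws ws∼ w∈))

  symmetric-Q : ∀ {q m} {ws : Vec (V n) m} → Symmetric q ws → ∀ i → Q (lookup ws i) ≡ q
  symmetric-Q {ws = w ∷ ws} (Qw , _ , _)  fzero    = Qw
  symmetric-Q {ws = w ∷ ws} (_ , _ , ws∼) (fsuc i) = symmetric-Q ws∼ i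

  symmetric-gram : ∀ {q m} (ws : Vec (V n) m) → Symmetric q ws →
    ∀ i j → B (lookup ws i) (lookup ws j) ≡ not (δ i j)
  symmetric-gram (w ∷ ws) _             fzero    fzero    = B-self w
  symmetric-gram (w ∷ ws) (_ , w∼ , _)  fzero    (fsuc j) = w∼ (∈-lookup j ws)
  symmetric-gram (w ∷ ws) (_ , w∼ , _)  (fsuc i) fzero    = B-sym≡ (w∼ (∈-lookup i ws))
  symmetric-gram (w ∷ ws) (_ , _ , ws∼) (fsuc i) (fsuc j) = symmetric-gram ws ws∼ i j

  -- The Gram matrix J - I of a symmetric family of even size is its own inverse over 𝔽₂,
  -- so the dual of the family is obtained by adding its sum to each member.
  symmetric⇒independent : ∀ k {q} (ws : Vec (V n) (dbl k)) → Symmetric q ws → Independent ws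
  symmetric⇒independent k ws ws∼ = dual⇒independent (map (sumᵛ ws ⊕_) ws) λ i j → begin
    B (lookup ws i) (lookup (map (sumᵛ ws ⊕_) ws) j)
      ≡⟨ cong (B (lookup ws i)) (lookup-map j (sumᵛ ws ⊕_) ws) ⟩
    B (lookup ws i) (sumᵛ ws ⊕ lookup ws j)
      ≡⟨ B-⊕ʳ≡ (B-sumᵛ-symmetric k ws ws∼ (∈-lookup i ws)) (symmetric-gram ws ws∼ i j) ⟩
    not (not (δ i j))
      ≡⟨ not-involutive (δ i j) ⟩
    δ i j
      ∎
    where open ≡-Reasoning

  lookups⇒symmetric : ∀ {m} (bs : Vec (V n) m) → (∀ i → Q (lookup bs i) ≡ false) →
    (∀ i j → i <ᶠ j → B (lookup bs i) (lookup bs j) ≡ true) → Symmetric false bs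
  lookups⇒symmetric []       _    _    = tt
  lookups⇒symmetric (b ∷ bs) Q-bs B-bs =
    Q-bs fzero ,
    lookup⇒∈ {P = λ v → B b v ≡ true} bs (λ j → B-bs fzero (fsuc j) (s≤s z≤n)) ,
    lookups⇒symmetric bs (λ i → Q-bs (fsuc i)) (λ i j i<j → B-bs (fsuc i) (fsuc j) (s≤s i<j))

  StandardBasis : Bool → ℕ → Set
  StandardBasis false k = Hyperbolic k Q
  StandardBasis true  k = Elliptic k Q

  decomposition⇒standardBasis : ∀ {a k m} {Y : Vec (V n) m} → Spanning Y → Decomposition Y a k →
    StandardBasis a k
  decomposition⇒standardBasis spans (hyperbolic e f hp (_ , Y⊆ef)) =
    e , f , (hyperbolic⇒independent {e = e} {f} hp , spanning-⊆⟨⟩ spans Y⊆ef) , hp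
  decomposition⇒standardBasis spans (elliptic e f p hp ef⊥p (_ , Y⊆efp)) =
    e , f , first p , second p ,
    (elliptic⇒independent {e = e} {f} p hp ef⊥p , spanning-⊆⟨⟩ spans Y⊆efp) , hp ,
    (λ i → ef⊥p (e∈ i) (here refl)) , (λ i → ef⊥p (e∈ i) (there (here refl))) ,
    (λ i → ef⊥p (f∈ i) (here refl)) , (λ i → ef⊥p (f∈ i) (there (here refl))) ,
    Q-first p , Q-second p , B-first-second p
    where
      e∈ = λ i → ∈-++⁺ˡ (∈-lookup i e)
      f∈ = λ i → ∈-++⁺ʳ e (∈-lookup i f)

  symmetric⇒standardBasis : ∀ r {m} (ws : Vec (V n) m) → m ≡ dbl r → Spanning ws → Symmetric false ws →
    StandardBasis (arf false r) r
  symmetric⇒standardBasis r ws refl spans ws∼ =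
    decomposition⇒standardBasis spans (symmetric⇒decomposition r false ws ws∼)

  symmetricBasis⇒standardBasis : ∀ r → n ≡ dbl r → HasSymmetricBasis Q → StandardBasis (arf false r) r
  symmetricBasis⇒standardBasis r n≡dbl (bs , (_ , spans) , Q-bs , B-bs) =
    symmetric⇒standardBasis r bs n≡dbl spans (lookups⇒symmetric bs Q-bs B-bs)

  symmetricBasis : ∀ {m} (ws : Vec (V n) m) → m ≡ n → IsBasis ws → Symmetric false ws → HasSymmetricBasis Q
  symmetricBasis ws refl basis ws∼ =
    ws , basis , symmetric-Q ws∼ , λ i j i<j → trans (symmetric-gram ws ws∼ i j) (cong not (δ-< i<j))

  decomposition⇒symmetricBasis : ∀ r {m} {Y : Vec (V n) m} → n ≡ dbl r → Spanning Y →
    Decomposition Y (arf false r) r → HasSymmetricBasis Q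
  decomposition⇒symmetricBasis r n≡dbl spans D with ws , ws∼ , ws≈Y ← decomposition⇒symmetric r false D =
    symmetricBasis ws (sym n≡dbl) (symmetric⇒independent r ws ws∼ , spanning-⊆⟨⟩ spans (proj₂ ws≈Y)) ws∼

  standardBasis⇒symmetricBasis : ∀ a r → n ≡ dbl r → a ≡ arf false r → StandardBasis a r → HasSymmetricBasis Q
  standardBasis⇒symmetricBasis false r n≡dbl a≡arf (e , f , (_ , spans) , hp) =
    decomposition⇒symmetricBasis r n≡dbl spans
      (subst (λ a → Decomposition (e ++ f) a r) a≡arf (hyperbolic e f hp SameSpan-refl))
  standardBasis⇒symmetricBasis true (suc j) n≡dbl a≡arf
    (e , f , x , y , (_ , spans) , hp , e⊥x , e⊥y , f⊥x , f⊥y , Q-x , Q-y , B-xy) =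
    decomposition⇒symmetricBasis (suc j) n≡dbl spans
      (subst (λ a → Decomposition (e ++ f ++ (x ∷ y ∷ [])) a (suc j)) a≡arf
        (elliptic e f (plane x y Q-x Q-y B-xy) hp ef⊥xy SameSpan-refl))
    where
      ef⊥xy : (e ++ f) ⊥* (x ∷ y ∷ [])
      ef⊥xy = ⊥*-++ˡ e (lookup⇒⊥* e (x ∷ y ∷ []) λ { i fzero → e⊥x i ; i (fsuc fzero) → e⊥y i })
                       (lookup⇒⊥* f (x ∷ y ∷ []) λ { i fzero → f⊥x i ; i (fsuc fzero) → f⊥y i })

arf-+2 : ∀ q k → arf q (suc (suc k)) ≡ not (arf q k)
arf-+2 false k = refl
arf-+2 true  k = refl

arf-%4 : ∀ q k → arf q (k % 4) ≡ arf q k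
arf-%4 q 0 = refl
arf-%4 q 1 = refl
arf-%4 q 2 = refl
arf-%4 q 3 = refl
arf-%4 q (suc (suc (suc (suc k)))) = begin
  arf q ((4 + k) % 4)   ≡⟨ cong (arf q) (trans (cong (_% 4) (+-comm 4 k)) ([m+n]%n≡m%n k 4)) ⟩
  arf q (k % 4)         ≡⟨ arf-%4 q k ⟩
  arf q k               ≡⟨ sym (not-involutive (arf q k)) ⟩
  not (not (arf q k))   ≡⟨ cong not (sym (arf-+2 q k)) ⟩
  not (arf q (2 + k))   ≡⟨ sym (arf-+2 q (2 + k)) ⟩
  arf q (4 + k)         ∎
  where open ≡-Reasoning

%4-cases : ∀ r → (r % 4 ≡ 0 ⊎ r % 4 ≡ 1) ⊎ (r % 4 ≡ 2 ⊎ r % 4 ≡ 3)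
%4-cases r with r % 4 | m%n<n r 4
... | 0 | _ = inj₁ (inj₁ refl)
... | 1 | _ = inj₁ (inj₂ refl)
... | 2 | _ = inj₂ (inj₁ refl)
... | 3 | _ = inj₂ (inj₂ refl)
... | suc (suc (suc (suc _))) | s≤s (s≤s (s≤s (s≤s ())))

arf-hyperbolic : ∀ r → r % 4 ≡ 0 ⊎ r % 4 ≡ 1 → arf false r ≡ false
arf-hyperbolic r (inj₁ r%4≡0) = trans (sym (arf-%4 false r)) (cong (arf false) r%4≡0)
arf-hyperbolic r (inj₂ r%4≡1) = trans (sym (arf-%4 false r)) (cong (arf false) r%4≡1)

arf-elliptic : ∀ r → r % 4 ≡ 2 ⊎ r % 4 ≡ 3 → arf false r ≡ true
arf-elliptic r (inj₁ r%4≡2) = trans (sym (arf-%4 false r)) (cong (arf false) r%4≡2)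
arf-elliptic r (inj₂ r%4≡3) = trans (sym (arf-%4 false r)) (cong (arf false) r%4≡3)

theorem3p1 : (r : ℕ) → 1 ≤ r → (Q : V (2 * r) → Bool) →
    IsQuadraticForm Q → Nondegenerate Q →
    (HasSymmetricBasis Q ⇔
    ((Hyperbolic r Q × (r % 4 ≡ 0 ⊎ r % 4 ≡ 1))
    ⊎ (Elliptic r Q × (r % 4 ≡ 2 ⊎ r % 4 ≡ 3))))
theorem3p1 r _ Q isQ _ = mk⇔ to from
  where
    open QuadraticSpace Q isQ
    n≡dbl : 2 * r ≡ dbl r
    n≡dbl = sym (dbl≡2* r)
    to : HasSymmetricBasis Q →
      (Hyperbolic r Q × (r % 4 ≡ 0 ⊎ r % 4 ≡ 1)) ⊎ (Elliptic r Q × (r % 4 ≡ 2 ⊎ r % 4 ≡ 3))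
    to symmetric with symmetricBasis⇒standardBasis r n≡dbl symmetric | %4-cases r
    ... | standard | inj₁ r%4 = inj₁ (subst (λ a → StandardBasis a r) (arf-hyperbolic r r%4) standard , r%4)
    ... | standard | inj₂ r%4 = inj₂ (subst (λ a → StandardBasis a r) (arf-elliptic r r%4) standard , r%4)
    from : (Hyperbolic r Q × (r % 4 ≡ 0 ⊎ r % 4 ≡ 1)) ⊎ (Elliptic r Q × (r % 4 ≡ 2 ⊎ r % 4 ≡ 3)) →
      HasSymmetricBasis Q
    from (inj₁ (H , r%4)) = standardBasis⇒symmetricBasis false r n≡dbl (sym (arf-hyperbolic r r%4)) H
    from (inj₂ (E , r%4)) = standardBasis⇒symmetricBasis true  r n≡dbl (sym (arf-elliptic r r%4)) E
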